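{- Let $\Lambda$ be the cross section lattice of a $J$-irreducible monoid of type $A_n$, $B_n$ or $C_n$, with $\Delta$ and $J_0$ as in the context. Then $\Lambda$ is supersolvable if and only if every connected component of $J_0$ is either a singleton $\{\alpha_i\}$ with $\alpha_i\in\Delta$, or is a subset $\widetilde{J_0}\subseteq\Delta$ whose induced subgraph in the Dynkin diagram is connected and contains an end-node of $\Delta$.
   Context: Let $K$ be an algebraically closed field, $G_0$ a simple algebraic group of type $A_n$, $B_n$ or $C_n$, $\rho:G_0\to GL(V)$ an irreducible rational representation, $G=K^*\cdot\rho(G_0)$, $M=\overline{G}\subseteq\mathrm{End}(V)$ its Zariski closure. A cross section lattice is a finite set $\Lambda$ of idempotents of $M$ meeting every $G\times G$-orbit in exactly one element, ordered by $e\le f\iff e=ef=fe$; it is a graded lattice with least element $0$ and unique minimal nonzero element $e_0$. Let $T=C_G(\Lambda)$, $B=\{g\in G:ge=ege\ \forall e\in\Lambda\}$, $\Delta=\{\alpha_1,\dots,\alpha_n\}$ the simple roots of $T$ relative to $B$, $\sigma_\alpha$ the simple reflections, $\phi(e)=\{\alpha\in\Delta:\sigma_\alpha e=e\sigma_\alpha\ne e\}$, $J_0=\{\alpha\in\Delta:\sigma_\alpha e_0=e_0\sigma_\alpha\}$. Two simple roots $\alpha\ne\beta$ are adjacent iff $\sigma_\alpha\sigma_\beta\ne\sigma_\beta\sigma_\alpha$; a simple root $\alpha$ is an end-node if exactly one $\alpha'\in\Delta$ is adjacent to it. By Putcha–Renner, $\phi|_{\Lambda\setminus\{0\}}$ is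 an order isomorphism onto the family of $I\subseteq\Delta$ (ordered by inclusion) no connected component of which lies entirely in $J_0$. A finite lattice is supersolvable if it has a maximal chain $\Gamma$ such that the sublattice generated by $\Gamma$ and any other chain of the lattice is distributive. -}

module Defs where

open import Level using (0ℓ)
open import Data.Nat using (ℕ; suc; _≥_)
open import Data.Fin using (Fin; toℕ)
open import Data.Fin.Subset using (Subset; _∈_; _⊆_; ⁅_⁆; Nonempty)
open import Data.Maybe using (Maybe; just; nothing)
open import Data.Product using (Σ; _×_; _,_; proj₁; ∃)
open import Data.Sum using (_⊎_)
open import Data.Empty using (⊥)
open import Data.Unit using (⊤)
open import Relation.Nullary using (¬_)
open import Relation.Binary.PropositionalEquality using (_≡_)

module LatticeTheory (A : Set) (_≈_ : A → A → Set) (_≤_ : A → A → Set) where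

  IsMeet : A → A → A → Set
  IsMeet x y z = (z ≤ x) × (z ≤ y) × (∀ w → w ≤ x → w ≤ y → w ≤ z)

  IsJoin : A → A → A → Set
  IsJoin x y z = (x ≤ z) × (y ≤ z) × (∀ w → x ≤ w → y ≤ w → z ≤ w)

  IsChain : (A → Set) → Set
  IsChain C = ∀ x y → C x → C y → (x ≤ y) ⊎ (y ≤ x)

  IsMaximalChain : (A → Set) → Set₁
  IsMaximalChain Γ =
    IsChain Γ × (∀ (C : A → Set) → IsChain C → (∀ x → Γ x → C x) →
                   ∀ x → C x → Σ A (λ y → Γ y × (x ≈ y)))

  data Generated (S : A → Set) : A → Set where
    gen  : ∀ {x} → S x → Generated S x
    meet : ∀ {x y z} → Generated S x → Generated S y → IsMeet x y z → Generated S z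
    join : ∀ {x y z} → Generated S x → Generated S y → IsJoin x y z → Generated S z

  IsDistributiveOn : (A → Set) → Set
  IsDistributiveOn L =
    ∀ x y z → L x → L y → L z →
    ∀ a b c d e → IsJoin y z a → IsMeet x a b → IsMeet x y c → IsMeet x z d →
    IsJoin c d e → b ≈ e

  Supersolvable : Set₁
  Supersolvable =
    Σ (A → Set) λ Γ → IsMaximalChain Γ ×
      (∀ (C : A → Set) → IsChain C → IsDistributiveOn (Generated (λ x → Γ x ⊎ C x)))

-- Dynkin diagrams of type A_n, B_n, C_n: the simple roots α_1..α_n are Fin n,
-- and α_i, α_j are adjacent iff |i - j| = 1 (the underlying graph is a path).

module Dynkin (n : ℕ) where

  Adjacent : Fin n → Fin n → Set
  Adjacent i j = (toℕ j ≡ suc (toℕ i)) ⊎ (toℕ i ≡ suc (toℕ j))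

  EndNode : Fin n → Set
  EndNode i = Σ (Fin n) λ j → Adjacent i j × (∀ k → Adjacent i k → k ≡ j)

  data PathIn (C : Subset n) (i : Fin n) : Fin n → Set where
    here : i ∈ C → PathIn C i i
    step : ∀ {j k} → PathIn C i j → Adjacent j k → k ∈ C → PathIn C i k

  Connected : Subset n → Set
  Connected C = ∀ i j → i ∈ C → j ∈ C → PathIn C i j

  IsComponent : Subset n → Subset n → Set
  IsComponent I C =
    Nonempty C × C ⊆ I × Connected C ×
    (∀ i j → i ∈ C → j ∈ I → Adjacent i j → j ∈ C)

  -- Putcha–Renner: Λ∖{0} ≅ { I ⊆ Δ : no connected component of I lies in J₀ }
  Admissible : Subset n → Subset n → Set
  Admissible J₀ I = ∀ C → IsComponent I C → ¬ (C ⊆ J₀)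

  -- elements of Λ: nothing = 0, just I = the idempotent e with φ(e) = I
  InΛ : Subset n → Maybe (Subset n) → Set
  InΛ J₀ nothing  = ⊤
  InΛ J₀ (just I) = Admissible J₀ I

  Λ : Subset n → Set
  Λ J₀ = Σ (Maybe (Subset n)) (InΛ J₀)

  _≈Λ_ : ∀ {J₀} → Λ J₀ → Λ J₀ → Set
  x ≈Λ y = proj₁ x ≡ proj₁ y

  leΛ : Maybe (Subset n) → Maybe (Subset n) → Set
  leΛ nothing  _        = ⊤
  leΛ (just I) nothing  = ⊥
  leΛ (just I) (just J) = I ⊆ J

  _≤Λ_ : ∀ {J₀} → Λ J₀ → Λ J₀ → Set
  x ≤Λ y = leΛ (proj₁ x) (proj₁ y)

  ΛSupersolvable : Subset n → Set₁
  ΛSupersolvable J₀ = LatticeTheory.Supersolvable (Λ J₀) _≈Λ_ _≤Λ_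

  ComponentCondition : Subset n → Set
  ComponentCondition J₀ =
    ∀ C → IsComponent J₀ C →
      (Σ (Fin n) λ i → C ≡ ⁅ i ⁆) ⊎
      (Connected C × Σ (Fin n) λ i → i ∈ C × EndNode i)

-- Joins in Λ are unions; a meet is the intersection whenever that intersection is again admissible.
--
-- Sufficiency. List the nodes outside J₀ first, then the nodes of a component of J₀ containing α₁
-- from right to left, then the remaining nodes of J₀ from left to right. Under the component
-- condition every node of J₀ is joined to the outside of J₀ through nodes listed before it, so for
-- every admissible c and every initial segment Γₜ of the list, c ∩ Γₜ is again admissible. Hence
-- the Γₜ form a maximal chain, and for any chain C the unions of sets c ∩ Γₜ (c ∈ C or c = Δ) are
-- admissible and closed under ∩ and ∪: in the sublattice generated by Γ and C, meets and joins are
-- intersections and unions, which distribute.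
--
-- Necessity. Let K = {α_a, …, α_b} be a component of J₀ with 1 < a < b < n and Γ a maximal chain.
-- An admissible set meeting K contains α_{a-1}α_a or α_bα_{b+1}; since Γ is a chain, all members
-- of Γ meeting K use the same end, say the left one. Let U be the largest member of Γ disjoint from K.
-- By maximality U ∪ {α_{a-1}} ∈ Γ, so α_{a-1} ∈ U, and then x = U ∪ {α_a} ∈ Γ. With y = U and
-- z = {α_a, …, α_{b+1}} one gets x ∧ (y ∨ z) = x but (x ∧ y) ∨ (x ∧ z) = y, as α_a cannot leave J₀
-- inside x ∩ z.

module Submission where

open import Defs
open import Data.Nat using (ℕ; zero; suc; pred; z<s; >-nonZero; _+_; _∸_; _⊓_; _≤_; _<_; _≥_; z≤n; s≤s; _≤?_; _<?_; _≟_)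
open import Data.Nat.Properties
open import Data.Fin using (Fin; toℕ; fromℕ<)
import Data.Fin as Fin
open import Data.Fin.Properties using (toℕ-injective; toℕ<n; toℕ-fromℕ<; any?; all?)
open import Data.Fin.Subset using (Subset; _∈_; _∉_; _⊆_; ⁅_⁆; _∩_; _∪_; ⊤)
open import Data.Fin.Subset.Properties using (_∈?_; _⊆?_; ∈⊤; x∈⁅x⁆; ⊆⊤; ∩-identityˡ; x∈⁅y⁆⇒x≡y; p∩q⊆p; p∩q⊆q; ∩-distribˡ-∪; ⊆-antisym; x∈p∩q⁺; x∈p∩q⁻; x∈p∪q⁻; p⊆p∪q; q⊆p∪q)
open import Data.Vec using (tabulate)
open import Data.Vec.Properties using ([]=⇒lookup; lookup⇒[]=; lookup∘tabulate)
open import Data.Product using (Σ; ∃; _×_; _,_; proj₁; proj₂)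
open import Data.Sum using (_⊎_; inj₁; inj₂; [_,_]′)
import Data.Sum as Sum
open import Data.Empty using (⊥-elim) renaming (⊥ to Empty)
open import Data.Unit using (tt) renaming (⊤ to Unit)
open import Data.Maybe using (Maybe; just; nothing)
open import Data.Maybe.Properties using (just-injective)
open import Relation.Nullary using (¬_; Dec; yes; no; does; contradiction; _×-dec_; _→-dec_; ¬?)
open import Relation.Nullary.Decidable using (dec-true; decidable-stable; ¬¬-excluded-middle)
open import Relation.Unary using (Decidable)
open import Relation.Binary using (tri<; tri≈; tri>)
open import Relation.Binary.PropositionalEquality

module Extent {P : ℕ → Set} (P? : Decidable P) where

  leftExtent : ∀ k → P k →
    ∃ λ l → l ≤ k × (∀ m → l ≤ m → m ≤ k → P m) × (∀ m → suc m ≡ l → ¬ P m)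
  leftExtent zero pk = 0 , z≤n , (λ m _ m≤0 → subst P (sym (n≤0⇒n≡0 m≤0)) pk) , λ _ ()
  leftExtent (suc k) pk with P? k
  ... | no ¬pk = suc k , ≤-refl , (λ m l≤m m≤k → subst P (sym (≤-antisym m≤k l≤m)) pk)
               , λ m e pm → ¬pk (subst P (suc-injective e) pm)
  ... | yes pk′ with leftExtent k pk′
  ...   | l , l≤k , run , out = l , m≤n⇒m≤1+n l≤k , run′ , out
    where
      run′ : ∀ m → l ≤ m → m ≤ suc k → P m
      run′ m l≤m m≤k with m ≟ suc k
      ... | yes refl = pk
      ... | no m≢k = run m l≤m (≤-pred (≤∧≢⇒< m≤k m≢k))

  rightExtent : ∀ {B} → (∀ m → B ≤ m → ¬ P m) → ∀ k → P k →
    ∃ λ r → k ≤ r × (∀ m → k ≤ m → m ≤ r → P m) × ¬ P (suc r)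
  rightExtent {B} bound k = go (B ∸ k) k (m≤n+m∸n B k)
    where
      go : ∀ f k → B ≤ k + f → P k → ∃ λ r → k ≤ r × (∀ m → k ≤ m → m ≤ r → P m) × ¬ P (suc r)
      go zero k B≤k pk = contradiction pk (bound k (≤-trans B≤k (≤-reflexive (+-identityʳ k))))
      go (suc f) k B≤ pk with P? (suc k)
      ... | no ¬pk = k , ≤-refl , (λ m k≤m m≤k → subst P (sym (≤-antisym m≤k k≤m)) pk) , ¬pk
      ... | yes pk′ with go f (suc k) (≤-trans B≤ (≤-reflexive (+-suc k f))) pk′
      ...   | r , k<r , run , out = r , ≤-trans (n≤1+n k) k<r , run′ , out
        where
          run′ : ∀ m → k ≤ m → m ≤ r → P m
          run′ m k≤m m≤r with m ≟ k
          ... | yes refl = pk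
          ... | no m≢k = run m (≤∧≢⇒< k≤m (λ e → m≢k (sym e))) m≤r

¬¬-decidable : ∀ {k} (P : Fin k → Set) → ¬ ¬ (∀ v → Dec (P v))
¬¬-decidable {zero} P never = never (λ ())
¬¬-decidable {suc k} P never =
  ¬¬-excluded-middle λ P0? → ¬¬-decidable (λ v → P (Fin.suc v)) λ Psuc? →
    never λ { Fin.zero → P0? ; (Fin.suc v) → Psuc? v }

module Subsets {n : ℕ} where

  setOf : {P : Fin n → Set} → Decidable P → Subset n
  setOf P? = tabulate (λ i → does (P? i))

  ∈-setOf⁺ : ∀ {P : Fin n → Set} (P? : Decidable P) {i} → P i → i ∈ setOf P?
  ∈-setOf⁺ P? {i} p = lookup⇒[]= i _ (trans (lookup∘tabulate _ i) (dec-true (P? i) p))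

  ∈-setOf⁻ : ∀ {P : Fin n → Set} (P? : Decidable P) {i} → i ∈ setOf P? → P i
  ∈-setOf⁻ P? {i} i∈ with P? i | trans (sym (lookup∘tabulate (λ j → does (P? j)) i)) ([]=⇒lookup i∈)
  ... | yes p | _ = p
  ... | no _ | ()

  ⊈⇒∃∉ : ∀ {A B : Subset n} → ¬ (A ⊆ B) → ∃ λ d → d ∈ A × d ∉ B
  ⊈⇒∃∉ {A} {B} A⊈B with any? (λ d → (d ∈? A) ×-dec ¬? (d ∈? B))
  ... | yes found = found
  ... | no none = contradiction (λ {d} d∈A → decidable-stable (d ∈? B) (λ d∉B → none (d , d∈A , d∉B))) A⊈B

module PathGraph {n : ℕ} where
  open Dynkin n
  open Subsets

  Adjacent-sym : ∀ {i j} → Adjacent i j → Adjacent j i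
  Adjacent-sym = Sum.swap

  Adjacent⇒≢ : ∀ {i j} → Adjacent i j → i ≢ j
  Adjacent⇒≢ (inj₁ e) refl = 1+n≢n (sym e)
  Adjacent⇒≢ (inj₂ e) refl = 1+n≢n (sym e)

  PathIn-mono : ∀ {S T i j} → S ⊆ T → PathIn S i j → PathIn T i j
  PathIn-mono S⊆T (here i∈) = here (S⊆T i∈)
  PathIn-mono S⊆T (step p adj k∈) = step (PathIn-mono S⊆T p) adj (S⊆T k∈)

  PathIn-closed : ∀ {I C i j} → (∀ a b → a ∈ C → b ∈ I → Adjacent a b → b ∈ C) →
                  i ∈ C → PathIn I i j → j ∈ C
  PathIn-closed closed i∈C (here _) = i∈C
  PathIn-closed closed i∈C (step p adj k∈) = closed _ _ (PathIn-closed closed i∈C p) k∈ adj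

  PathIn-cons : ∀ {S i j k} → i ∈ S → Adjacent i j → PathIn S j k → PathIn S i k
  PathIn-cons i∈ adj (here j∈) = step (here i∈) adj j∈
  PathIn-cons i∈ adj (step p adj′ k∈) = step (PathIn-cons i∈ adj p) adj′ k∈

  PathIn-reverse : ∀ {S i j} → PathIn S i j → PathIn S j i
  PathIn-reverse (here i∈) = here i∈
  PathIn-reverse (step p adj k∈) = PathIn-cons k∈ (Adjacent-sym adj) (PathIn-reverse p)

  Between : Fin n → Fin n → Fin n → Set
  Between u v m = (toℕ u ≤ toℕ m × toℕ m ≤ toℕ v) ⊎ (toℕ v ≤ toℕ m × toℕ m ≤ toℕ u)

  Between-refl : ∀ {u m} → Between u u m → m ≡ u
  Between-refl (inj₁ (u≤m , m≤u)) = toℕ-injective (≤-antisym m≤u u≤m)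
  Between-refl (inj₂ (u≤m , m≤u)) = toℕ-injective (≤-antisym m≤u u≤m)

  private
    ascendingPath : ∀ {S} k u v → toℕ v ≡ toℕ u + k →
      (∀ m → toℕ u ≤ toℕ m → toℕ m ≤ toℕ v → m ∈ S) → PathIn S u v
    ascendingPath zero u v v≡u inS rewrite toℕ-injective {i = v} {j = u} (trans v≡u (+-identityʳ _)) =
      here (inS u ≤-refl ≤-refl)
    ascendingPath (suc k) u v v≡u+k inS =
      step (ascendingPath k u v′ (toℕ-fromℕ< v′<n) inS′) (inj₁ v≡1+v′) (inS v u≤v ≤-refl)
      where
        v≡ : toℕ v ≡ suc (toℕ u + k)
        v≡ = trans v≡u+k (+-suc (toℕ u) k)
        v′<n : toℕ u + k < n
        v′<n = subst (_≤ n) v≡ (<⇒≤ (toℕ<n v))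
        v′ : Fin n
        v′ = fromℕ< v′<n
        v≡1+v′ : toℕ v ≡ suc (toℕ v′)
        v≡1+v′ = trans v≡ (cong suc (sym (toℕ-fromℕ< v′<n)))
        u≤v : toℕ u ≤ toℕ v
        u≤v = ≤-trans (m≤m+n (toℕ u) (suc k)) (≤-reflexive (sym v≡u+k))
        inS′ : ∀ m → toℕ u ≤ toℕ m → toℕ m ≤ toℕ v′ → m ∈ _
        inS′ m u≤m m≤v′ = inS m u≤m (≤-trans m≤v′ (≤-trans (n≤1+n _) (≤-reflexive (sym v≡1+v′))))

  pathBetween : ∀ {S} u v → (∀ m → Between u v m → m ∈ S) → PathIn S u v
  pathBetween u v inS with ≤-total (toℕ u) (toℕ v)
  ... | inj₁ u≤v = ascendingPath (toℕ v ∸ toℕ u) u v (sym (m+[n∸m]≡n u≤v)) λ m a b → inS m (inj₁ (a , b))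
  ... | inj₂ v≤u = PathIn-reverse
        (ascendingPath (toℕ u ∸ toℕ v) v u (sym (m+[n∸m]≡n v≤u)) λ m a b → inS m (inj₂ (a , b)))

  nodeAt : ∀ {m} → m < n → ∃ λ j → toℕ j ≡ m
  nodeAt m<n = fromℕ< m<n , toℕ-fromℕ< m<n

  predecessor : ∀ v → 0 < toℕ v → ∃ λ p → suc (toℕ p) ≡ toℕ v
  predecessor v pos with toℕ v in eq
  ... | suc k with nodeAt {k} (<⇒≤ (subst (_< n) eq (toℕ<n v)))
  ...   | p , p≡k = p , cong suc p≡k

  stepToward : ∀ u d → u ≢ d → ∃ λ m → Adjacent u m × Between u d m
  stepToward u d u≢d with <-cmp (toℕ u) (toℕ d)
  ... | tri≈ _ u≡d _ = contradiction (toℕ-injective u≡d) u≢d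
  ... | tri< u<d _ _ with nodeAt (≤-<-trans u<d (toℕ<n d))
  ...   | s , s≡ = s , inj₁ s≡ , inj₁ (≤-trans (n≤1+n _) (≤-reflexive (sym s≡)) , subst (_≤ toℕ d) (sym s≡) u<d)
  stepToward u d u≢d | tri> _ _ d<u with predecessor u (≤-<-trans z≤n d<u)
  ...   | p , p≡ = p , inj₂ (sym p≡) , inj₂ (≤-pred (subst (suc (toℕ d) ≤_) (sym p≡) d<u) , ≤-trans (n≤1+n _) (≤-reflexive p≡))

  -- Opaque so that l and r can be inferred from a proof of i ∈ interval l r.
  opaque
    interval : ℕ → ℕ → Subset n
    interval l r = setOf (λ i → (l ≤? toℕ i) ×-dec (toℕ i ≤? r))

    ∈-interval⁺ : ∀ {l r i} → l ≤ toℕ i → toℕ i ≤ r → i ∈ interval l r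
    ∈-interval⁺ {l} {r} l≤i i≤r = ∈-setOf⁺ (λ i → (l ≤? toℕ i) ×-dec (toℕ i ≤? r)) (l≤i , i≤r)

    ∈-interval⁻ : ∀ {l r i} → i ∈ interval l r → l ≤ toℕ i × toℕ i ≤ r
    ∈-interval⁻ {l} {r} = ∈-setOf⁻ (λ i → (l ≤? toℕ i) ×-dec (toℕ i ≤? r))

  interval-convex : ∀ {l r u v m} → u ∈ interval l r → v ∈ interval l r → Between u v m → m ∈ interval l r
  interval-convex u∈ v∈ (inj₁ (u≤m , m≤v)) =
    ∈-interval⁺ (≤-trans (proj₁ (∈-interval⁻ u∈)) u≤m) (≤-trans m≤v (proj₂ (∈-interval⁻ v∈)))
  interval-convex u∈ v∈ (inj₂ (v≤m , m≤u)) =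
    ∈-interval⁺ (≤-trans (proj₁ (∈-interval⁻ v∈)) v≤m) (≤-trans m≤u (proj₂ (∈-interval⁻ u∈)))

  interval-connected : ∀ l r → Connected (interval l r)
  interval-connected l r u v u∈ v∈ = pathBetween u v λ m → interval-convex u∈ v∈

  IndexOf : Subset n → ℕ → Set
  IndexOf I m = ∃ λ j → toℕ j ≡ m × j ∈ I

  indexOf? : ∀ I → Decidable (IndexOf I)
  indexOf? I m = any? (λ j → (toℕ j ≟ m) ×-dec (j ∈? I))

  IndexOf⇒∈ : ∀ {I i} → IndexOf I (toℕ i) → i ∈ I
  IndexOf⇒∈ {I} (j , j≡i , j∈) = subst (_∈ I) (toℕ-injective j≡i) j∈

  IndexOf⇒< : ∀ {I m} → IndexOf I m → m < n
  IndexOf⇒< (j , refl , _) = toℕ<n j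

  record IntervalComponent (I : Subset n) (i : Fin n) : Set where
    field
      l r : ℕ
      l≤i : l ≤ toℕ i
      i≤r : toℕ i ≤ r
      r<n : r < n
      inside : ∀ m → l ≤ toℕ m → toℕ m ≤ r → m ∈ I
      leftOut : ∀ m → suc (toℕ m) ≡ l → m ∉ I
      rightOut : ∀ m → toℕ m ≡ suc r → m ∉ I

    carrier : Subset n
    carrier = interval l r

    i∈carrier : i ∈ carrier
    i∈carrier = ∈-interval⁺ l≤i i≤r

    carrier⊆ : carrier ⊆ I
    carrier⊆ m∈ = inside _ (proj₁ (∈-interval⁻ m∈)) (proj₂ (∈-interval⁻ m∈))

    isComponent : IsComponent I carrier
    isComponent = (i , i∈carrier) , carrier⊆ , interval-connected l r , closed
      where
        closed : ∀ a b → a ∈ carrier → b ∈ I → Adjacent a b → b ∈ carrier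
        closed a b a∈ b∈I (inj₁ b≡) with toℕ b ≤? r
        ... | yes b≤r = ∈-interval⁺ (≤-trans (proj₁ (∈-interval⁻ a∈)) (≤-trans (n≤1+n _) (≤-reflexive (sym b≡)))) b≤r
        ... | no b≰r = contradiction b∈I (rightOut b (≤-antisym (subst (_≤ suc r) (sym b≡) (s≤s (proj₂ (∈-interval⁻ a∈)))) (≰⇒> b≰r)))
        closed a b a∈ b∈I (inj₂ a≡) with l ≤? toℕ b
        ... | yes l≤b = ∈-interval⁺ l≤b (≤-trans (n≤1+n _) (subst (_≤ r) a≡ (proj₂ (∈-interval⁻ a∈))))
        ... | no l≰b = contradiction b∈I (leftOut b (≤-antisym (≰⇒> l≰b) (subst (l ≤_) a≡ (proj₁ (∈-interval⁻ a∈)))))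

  intervalComponent : ∀ {I i} → i ∈ I → IntervalComponent I i
  intervalComponent {I} {i} i∈ with Extent.leftExtent (indexOf? I) (toℕ i) (i , refl , i∈)
                                   | Extent.rightExtent (indexOf? I) (λ m n≤m im → <⇒≱ (IndexOf⇒< im) n≤m) (toℕ i) (i , refl , i∈)
  ... | l , l≤i , runˡ , outˡ | r , i≤r , runʳ , outʳ = record
    { l = l ; r = r ; l≤i = l≤i ; i≤r = i≤r ; r<n = IndexOf⇒< (runʳ r i≤r ≤-refl)
    ; inside = inside
    ; leftOut = λ m m≡ m∈ → outˡ (toℕ m) m≡ (m , refl , m∈)
    ; rightOut = λ m m≡ m∈ → outʳ (m , m≡ , m∈) }
    where
      inside : ∀ m → l ≤ toℕ m → toℕ m ≤ r → m ∈ I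
      inside m l≤m m≤r with ≤-total (toℕ m) (toℕ i)
      ... | inj₁ m≤i = IndexOf⇒∈ (runˡ (toℕ m) l≤m m≤i)
      ... | inj₂ i≤m = IndexOf⇒∈ (runʳ (toℕ m) i≤m m≤r)

  components-coincide : ∀ {I C D i} → IsComponent I C → IsComponent I D → i ∈ C → i ∈ D → C ≡ D
  components-coincide {i = i} (_ , C⊆I , C-conn , C-closed) (_ , D⊆I , D-conn , D-closed) i∈C i∈D =
    ⊆-antisym (λ {j} j∈C → PathIn-closed D-closed i∈D (PathIn-mono C⊆I (C-conn i j i∈C j∈C)))
              (λ {j} j∈D → PathIn-closed C-closed i∈C (PathIn-mono D⊆I (D-conn i j i∈D j∈D)))

  Between-adjacent : ∀ {u v m} → Adjacent u v → Between u v m → m ≡ u ⊎ m ≡ v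
  Between-adjacent {u} {v} {m} adj btw with toℕ m ≟ toℕ u
  ... | yes m≡u = inj₁ (toℕ-injective m≡u)
  ... | no m≢u = inj₂ (toℕ-injective (squeeze adj btw))
    where
      squeeze : Adjacent u v → Between u v m → toℕ m ≡ toℕ v
      squeeze (inj₁ v≡) (inj₁ (u≤m , m≤v)) = ≤-antisym m≤v (subst (_≤ toℕ m) (sym v≡) (≤∧≢⇒< u≤m (λ e → m≢u (sym e))))
      squeeze (inj₁ v≡) (inj₂ (v≤m , m≤u)) = contradiction (≤-trans (≤-reflexive (sym v≡)) (≤-trans v≤m m≤u)) (1+n≰n)
      squeeze (inj₂ u≡) (inj₁ (u≤m , m≤v)) = contradiction (≤-trans (≤-reflexive (sym u≡)) (≤-trans u≤m m≤v)) (1+n≰n)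
      squeeze (inj₂ u≡) (inj₂ (v≤m , m≤u)) = sym (≤-antisym v≤m (≤-pred (subst (suc (toℕ m) ≤_) u≡ (≤∧≢⇒< m≤u m≢u))))

  Between-ascending : ∀ {u v m} → toℕ u ≤ toℕ v → Between u v m → toℕ u ≤ toℕ m × toℕ m ≤ toℕ v
  Between-ascending u≤v (inj₁ bounds) = bounds
  Between-ascending u≤v (inj₂ (v≤m , m≤u)) = ≤-trans u≤v v≤m , ≤-trans m≤u u≤v

  Between-descending : ∀ {u v m} → toℕ v ≤ toℕ u → Between u v m → toℕ v ≤ toℕ m × toℕ m ≤ toℕ u
  Between-descending v≤u (inj₂ bounds) = bounds
  Between-descending v≤u (inj₁ (u≤m , m≤v)) = ≤-trans v≤u u≤m , ≤-trans m≤v v≤u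

  EndNode⇒extreme : ∀ {e} → EndNode e → toℕ e ≡ 0 ⊎ suc (toℕ e) ≡ n
  EndNode⇒extreme {e} (j , _ , unique) with toℕ e | toℕ<n e
  ... | zero | _ = inj₁ refl
  ... | suc k | e<n with suc (suc k) ≟ n
  ...   | yes last = inj₂ last
  ...   | no ¬last = contradiction (cong toℕ (trans (unique s (inj₁ s≡))
                                                   (sym (unique p (inj₂ (cong suc (sym p≡)))))))
                                   (λ s≡p → <⇒≢ (m≤n⇒m≤1+n (n<1+n k)) (sym (trans (sym s≡) (trans s≡p p≡))))
    where
      s = proj₁ (nodeAt (≤∧≢⇒< e<n ¬last))
      s≡ = proj₂ (nodeAt (≤∧≢⇒< e<n ¬last))
      p = proj₁ (nodeAt {k} (<⇒≤ e<n))
      p≡ = proj₂ (nodeAt {k} (<⇒≤ e<n))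

  EndNode-first : ∀ {e f} → toℕ e ≡ 0 → toℕ f ≡ 1 → EndNode e
  EndNode-first {e} {f} e≡0 f≡1 = f , inj₁ (trans f≡1 (cong suc (sym e≡0))) , unique
    where
      unique : ∀ k → Adjacent e k → k ≡ f
      unique k (inj₁ k≡) = toℕ-injective (trans k≡ (trans (cong suc e≡0) (sym f≡1)))
      unique k (inj₂ e≡) = contradiction (trans (sym e≡0) e≡) 0≢1+n

  EndNode-last : ∀ {e f} → suc (toℕ e) ≡ n → suc (toℕ f) ≡ toℕ e → EndNode e
  EndNode-last {e} {f} 1+e≡n 1+f≡e = f , inj₂ (sym 1+f≡e) , unique
    where
      unique : ∀ k → Adjacent e k → k ≡ f
      unique k (inj₁ k≡) = contradiction (trans k≡ 1+e≡n) (<⇒≢ (toℕ<n k))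
      unique k (inj₂ e≡) = toℕ-injective (suc-injective (trans (sym e≡) (sym 1+f≡e)))

module Admissibility {n : ℕ} (J₀ : Subset n) where
  open Dynkin n
  open Subsets
  open PathGraph

  Reaches : Subset n → Set
  Reaches I = ∀ i → i ∈ I → ∃ λ d → d ∉ J₀ × PathIn I i d

  Exit : Subset n → Fin n → Set
  Exit I i = ∃ λ d → d ∉ J₀ × (∀ m → Between i d m → m ∈ I)

  Reaches⇒Admissible : ∀ {I} → Reaches I → Admissible J₀ I
  Reaches⇒Admissible reach C ((i , i∈C) , C⊆I , _ , closed) C⊆J₀ with reach i (C⊆I i∈C)
  ... | d , d∉J₀ , path = d∉J₀ (C⊆J₀ (PathIn-closed closed i∈C path))

  Admissible⇒Exit : ∀ {I i} → Admissible J₀ I → i ∈ I → Exit I i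
  Admissible⇒Exit adm i∈ =
    let d , d∈ , d∉J₀ = ⊈⇒∃∉ (adm carrier isComponent)
    in d , d∉J₀ , λ m btw → carrier⊆ (interval-convex i∈carrier d∈ btw)
    where open IntervalComponent (intervalComponent i∈)

  Exit⇒Reaches : ∀ {I} → (∀ i → i ∈ I → Exit I i) → Reaches I
  Exit⇒Reaches exit i i∈ with exit i i∈
  ... | d , d∉J₀ , between = d , d∉J₀ , pathBetween i d between

  Admissible⇒Reaches : ∀ {I} → Admissible J₀ I → Reaches I
  Admissible⇒Reaches adm = Exit⇒Reaches λ i → Admissible⇒Exit adm

  Reaches-∪ : ∀ {X Y} → Reaches X → Reaches Y → Reaches (X ∪ Y)
  Reaches-∪ {X} {Y} reachX reachY i i∈ with x∈p∪q⁻ X Y i∈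
  ... | inj₁ i∈X = let d , d∉J₀ , path = reachX i i∈X in d , d∉J₀ , PathIn-mono (p⊆p∪q Y) path
  ... | inj₂ i∈Y = let d , d∉J₀ , path = reachY i i∈Y in d , d∉J₀ , PathIn-mono (q⊆p∪q X Y) path

  Admissible-∪ : ∀ {X Y} → Admissible J₀ X → Admissible J₀ Y → Admissible J₀ (X ∪ Y)
  Admissible-∪ admX admY = Reaches⇒Admissible (Reaches-∪ (Admissible⇒Reaches admX) (Admissible⇒Reaches admY))

  Admissible-outside : ∀ {X} → (∀ m → m ∈ X → m ∉ J₀) → Admissible J₀ X
  Admissible-outside outside = Reaches⇒Admissible λ i i∈ → i , outside i i∈ , here i∈

  Admissible⇒meets-outside : ∀ {X i} → Admissible J₀ X → i ∈ X → ∃ λ d → d ∉ J₀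
  Admissible⇒meets-outside adm i∈ = let d , d∉J₀ , _ = Admissible⇒Exit adm i∈ in d , d∉J₀

  Admissible-⊤ : ∀ {d} → d ∉ J₀ → Admissible J₀ ⊤
  Admissible-⊤ {d} d∉J₀ = Reaches⇒Admissible λ i _ → d , d∉J₀ , pathBetween i d (λ _ _ → ∈⊤)

module CrossSectionLattice {n : ℕ} (J₀ : Subset n) where
  open Dynkin n
  open Admissibility J₀
  open LatticeTheory (Λ J₀) _≈Λ_ _≤Λ_ public

  leΛ-refl : ∀ a → leΛ a a
  leΛ-refl nothing = tt
  leΛ-refl (just A) = λ a∈ → a∈

  leΛ-antisym : ∀ {a b} → leΛ a b → leΛ b a → a ≡ b
  leΛ-antisym {nothing} {nothing} _ _ = refl
  leΛ-antisym {just A} {just B} A⊆B B⊆A = cong just (⊆-antisym A⊆B B⊆A)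

  IsMeet-unique : ∀ x y z z′ → IsMeet x y z → IsMeet x y z′ → z ≈Λ z′
  IsMeet-unique x y z z′ (z≤x , z≤y , glb) (z′≤x , z′≤y , glb′) = leΛ-antisym (glb′ z z≤x z≤y) (glb z′ z′≤x z′≤y)

  IsJoin-unique : ∀ x y z z′ → IsJoin x y z → IsJoin x y z′ → z ≈Λ z′
  IsJoin-unique x y z z′ (x≤z , y≤z , lub) (x≤z′ , y≤z′ , lub′) = leΛ-antisym (lub z′ x≤z′ y≤z′) (lub′ z x≤z y≤z)

  isMeet-just : ∀ {X Y Z} ax ay az → Z ⊆ X → Z ⊆ Y →
    (∀ V → Admissible J₀ V → V ⊆ X → V ⊆ Y → V ⊆ Z) →
    IsMeet (just X , ax) (just Y , ay) (just Z , az)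
  isMeet-just _ _ _ Z⊆X Z⊆Y glb = Z⊆X , Z⊆Y , λ { (nothing , _) _ _ → tt ; (just V , adm) V⊆X V⊆Y → glb V adm V⊆X V⊆Y }

  isJoin-just : ∀ {X Y Z} ax ay az → X ⊆ Z → Y ⊆ Z → Z ⊆ X ∪ Y →
    IsJoin (just X , ax) (just Y , ay) (just Z , az)
  isJoin-just {X} {Y} _ _ _ X⊆Z Y⊆Z Z⊆X∪Y =
    X⊆Z , Y⊆Z , λ { (nothing , _) () _
                  ; (just V , _) X⊆V Y⊆V m∈ → [ X⊆V , Y⊆V ]′ (x∈p∪q⁻ X Y (Z⊆X∪Y m∈)) }

  distributive-collapse : ∀ {L X Y Z} ax ay az → IsDistributiveOn L →
    L (just X , ax) → L (just Y , ay) → L (just Z , az) →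
    Y ⊆ X → X ⊆ Y ∪ Z → Admissible J₀ (Y ∩ Z) →
    (∀ V → Admissible J₀ V → V ⊆ X → V ⊆ Z → V ⊆ Y) → X ≡ Y
  distributive-collapse {X = X} {Y} {Z} ax ay az distributive Lx Ly Lz Y⊆X X⊆Y∪Z ayz glb =
    just-injective (distributive x y z Lx Ly Lz a x y d y
      (isJoin-just ay az (Admissible-∪ ay az) (p⊆p∪q Z) (q⊆p∪q Y Z) (λ {m} m∈ → m∈))
      (isMeet-just ax (Admissible-∪ ay az) ax (λ {m} m∈ → m∈) X⊆Y∪Z (λ V _ V⊆X _ → V⊆X))
      (isMeet-just ax ay ay Y⊆X (λ {m} m∈ → m∈) (λ V _ _ V⊆Y → V⊆Y))
      (isMeet-just ax az ayz (λ m∈ → Y⊆X (p∩q⊆p Y Z m∈)) (p∩q⊆q Y Z)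
                   (λ V adV V⊆X V⊆Z m∈ → x∈p∩q⁺ (glb V adV V⊆X V⊆Z m∈ , V⊆Z m∈)))
      (isJoin-just ay ayz ay (λ {m} m∈ → m∈) (p∩q⊆p Y Z) (p⊆p∪q (Y ∩ Z))))
    where
      x y z a d : Λ J₀
      x = just X , ax
      y = just Y , ay
      z = just Z , az
      a = just (Y ∪ Z) , Admissible-∪ ay az
      d = just (Y ∩ Z) , ayz

  meetᴹ joinᴹ : Maybe (Subset n) → Maybe (Subset n) → Maybe (Subset n)
  meetᴹ (just X) (just Y) = just (X ∩ Y)
  meetᴹ _ _ = nothing
  joinᴹ nothing b = b
  joinᴹ (just X) nothing = just X
  joinᴹ (just X) (just Y) = just (X ∪ Y)

  meetᴹ-distribˡ-joinᴹ : ∀ a b c → meetᴹ a (joinᴹ b c) ≡ joinᴹ (meetᴹ a b) (meetᴹ a c)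
  meetᴹ-distribˡ-joinᴹ nothing b c = refl
  meetᴹ-distribˡ-joinᴹ (just X) nothing nothing = refl
  meetᴹ-distribˡ-joinᴹ (just X) nothing (just Z) = refl
  meetᴹ-distribˡ-joinᴹ (just X) (just Y) nothing = refl
  meetᴹ-distribˡ-joinᴹ (just X) (just Y) (just Z) = cong just (∩-distribˡ-∪ X Y Z)

  module Distributive (Q : Subset n → Set) (Q⇒Admissible : ∀ {X} → Q X → Admissible J₀ X)
                      (Q-∩ : ∀ {X Y} → Q X → Q Y → Q (X ∩ Y)) (Q-∪ : ∀ {X Y} → Q X → Q Y → Q (X ∪ Y)) where

    Q̂ : Maybe (Subset n) → Set
    Q̂ nothing = Unit
    Q̂ (just X) = Q X

    meet-computed : ∀ x y z → Q̂ (proj₁ x) → Q̂ (proj₁ y) → IsMeet x y z → proj₁ z ≡ meetᴹ (proj₁ x) (proj₁ y)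
    meet-computed x@(nothing , _) y z _ _ x∧y = IsMeet-unique x y z (nothing , tt) x∧y (tt , tt , λ _ w≤x _ → w≤x)
    meet-computed x@(just X , _) y@(nothing , _) z _ _ x∧y = IsMeet-unique x y z (nothing , tt) x∧y (tt , tt , λ _ _ w≤y → w≤y)
    meet-computed x@(just X , adX) y@(just Y , adY) z qX qY x∧y =
      IsMeet-unique x y z (just (X ∩ Y) , adX∩Y) x∧y
        (isMeet-just adX adY adX∩Y (p∩q⊆p X Y) (p∩q⊆q X Y) λ V _ V⊆X V⊆Y m∈ → x∈p∩q⁺ (V⊆X m∈ , V⊆Y m∈))
      where adX∩Y = Q⇒Admissible (Q-∩ qX qY)

    join-computed : ∀ x y z → Q̂ (proj₁ x) → Q̂ (proj₁ y) → IsJoin x y z → proj₁ z ≡ joinᴹ (proj₁ x) (proj₁ y)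
    join-computed x@(nothing , _) y z _ _ x∨y = IsJoin-unique x y z y x∨y (tt , leΛ-refl (proj₁ y) , λ _ _ y≤w → y≤w)
    join-computed x@(just X , _) y@(nothing , _) z _ _ x∨y = IsJoin-unique x y z x x∨y (leΛ-refl (just X) , tt , λ _ x≤w _ → x≤w)
    join-computed x@(just X , adX) y@(just Y , adY) z _ _ x∨y =
      IsJoin-unique x y z (just (X ∪ Y) , adX∪Y) x∨y (isJoin-just adX adY adX∪Y (p⊆p∪q Y) (q⊆p∪q X Y) (λ {m} m∈ → m∈))
      where adX∪Y = Admissible-∪ adX adY

    Q̂-meetᴹ : ∀ a b → Q̂ a → Q̂ b → Q̂ (meetᴹ a b)
    Q̂-meetᴹ nothing _ _ _ = tt
    Q̂-meetᴹ (just X) nothing _ _ = tt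
    Q̂-meetᴹ (just X) (just Y) qX qY = Q-∩ qX qY

    Q̂-joinᴹ : ∀ a b → Q̂ a → Q̂ b → Q̂ (joinᴹ a b)
    Q̂-joinᴹ nothing _ _ qb = qb
    Q̂-joinᴹ (just X) nothing qX _ = qX
    Q̂-joinᴹ (just X) (just Y) qX qY = Q-∪ qX qY

    module _ {S : Λ J₀ → Set} (S⇒Q̂ : ∀ x → S x → Q̂ (proj₁ x)) where

      Generated⇒Q̂ : ∀ {x} → Generated S x → Q̂ (proj₁ x)
      Generated⇒Q̂ (gen s) = S⇒Q̂ _ s
      Generated⇒Q̂ {z} (meet {x} {y} gx gy x∧y) =
        subst Q̂ (sym (meet-computed x y z (Generated⇒Q̂ gx) (Generated⇒Q̂ gy) x∧y))
              (Q̂-meetᴹ (proj₁ x) (proj₁ y) (Generated⇒Q̂ gx) (Generated⇒Q̂ gy))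
      Generated⇒Q̂ {z} (join {x} {y} gx gy x∨y) =
        subst Q̂ (sym (join-computed x y z (Generated⇒Q̂ gx) (Generated⇒Q̂ gy) x∨y))
              (Q̂-joinᴹ (proj₁ x) (proj₁ y) (Generated⇒Q̂ gx) (Generated⇒Q̂ gy))

      Generated-distributive : IsDistributiveOn (Generated S)
      Generated-distributive x y z gx gy gz a b c d e y∨z x∧a x∧y x∧z c∨d =
        begin
          proj₁ b                                           ≡⟨ meet-computed x a b qx qa x∧a ⟩
          meetᴹ (proj₁ x) (proj₁ a)                          ≡⟨ cong (meetᴹ (proj₁ x)) (join-computed y z a qy qz y∨z) ⟩
          meetᴹ (proj₁ x) (joinᴹ (proj₁ y) (proj₁ z))        ≡⟨ meetᴹ-distribˡ-joinᴹ (proj₁ x) (proj₁ y) (proj₁ z) ⟩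
          joinᴹ (meetᴹ (proj₁ x) (proj₁ y)) (meetᴹ (proj₁ x) (proj₁ z))
            ≡⟨ sym (cong₂ joinᴹ (meet-computed x y c qx qy x∧y) (meet-computed x z d qx qz x∧z)) ⟩
          joinᴹ (proj₁ c) (proj₁ d)                          ≡⟨ sym (join-computed c d e qc qd c∨d) ⟩
          proj₁ e                                           ∎
        where
          open ≡-Reasoning
          qx = Generated⇒Q̂ gx
          qy = Generated⇒Q̂ gy
          qz = Generated⇒Q̂ gz
          qa = Generated⇒Q̂ {a} (join gy gz y∨z)
          qc = Generated⇒Q̂ {c} (meet gx gy x∧y)
          qd = Generated⇒Q̂ {d} (meet gx gz x∧z)

module Filtration {n : ℕ} (g : ℕ → Subset n) (N : ℕ)
                  (g-zero : ∀ v → v ∉ g 0) (g-full : ∀ v → v ∈ g N)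
                  (g-step : ∀ t {u v} → u ∈ g (suc t) → u ∉ g t → v ∈ g (suc t) → v ∉ g t → u ≡ v) where
  open Subsets

  squeezed : ∀ {X} k → g k ⊆ X → X ⊆ g (suc k) → X ≡ g k ⊎ X ≡ g (suc k)
  squeezed {X} k below above with X ⊆? g k
  ... | yes X⊆ = inj₁ (⊆-antisym X⊆ below)
  ... | no X⊈ = inj₂ (⊆-antisym above g⊆X)
    where
      v = proj₁ (⊈⇒∃∉ X⊈)
      v∈X = proj₁ (proj₂ (⊈⇒∃∉ X⊈))
      v∉ = proj₂ (proj₂ (⊈⇒∃∉ X⊈))
      g⊆X : g (suc k) ⊆ X
      g⊆X {u} u∈ with u ∈? g k
      ... | yes u∈g = below u∈g
      ... | no u∉ = subst (_∈ X) (g-step k (above v∈X) v∉ u∈ u∉) v∈X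

  comparable⇒stage : ∀ X → (∀ t → X ⊆ g t ⊎ g t ⊆ X) → ∃ λ t → X ≡ g t
  comparable⇒stage X comparable = climb 0 N refl (λ v∈ → contradiction v∈ (g-zero _))
    where
      climb : ∀ k f → k + f ≡ N → g k ⊆ X → ∃ λ t → X ≡ g t
      climb k zero k≡N below = k , ⊆-antisym (λ {v} _ → subst (λ t → v ∈ g t) (sym (trans (sym (+-identityʳ k)) k≡N)) (g-full v)) below
      climb k (suc f) k+f≡N below with comparable (suc k)
      ... | inj₂ above = climb (suc k) f (trans (sym (+-suc k f)) k+f≡N) above
      ... | inj₁ X⊆ with squeezed k below X⊆
      ...   | inj₁ X≡ = k , X≡
      ...   | inj₂ X≡ = suc k , X≡

module Weight {n : ℕ} (J₀ : Subset n) where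
  open Dynkin n

  LeftEnd RightEnd Isolated : Fin n → Set
  LeftEnd v = ∀ m → toℕ m ≤ toℕ v → m ∈ J₀
  RightEnd v = ∀ m → toℕ v ≤ toℕ m → m ∈ J₀
  Isolated v = ∀ m → Adjacent v m → m ∉ J₀

  leftEnd? : Decidable LeftEnd
  leftEnd? v = all? (λ m → (toℕ m ≤? toℕ v) →-dec (m ∈? J₀))

  weight : Fin n → ℕ
  weight v with v ∈? J₀ | leftEnd? v
  ... | no _  | _     = toℕ v
  ... | yes _ | yes _ = n + (n ∸ suc (toℕ v))
  ... | yes _ | no _  = n + n + toℕ v

  data WeightView (v : Fin n) : ℕ → Set where
    outside : v ∉ J₀ → WeightView v (toℕ v)
    leftEnd : v ∈ J₀ → LeftEnd v → WeightView v (n + (n ∸ suc (toℕ v)))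
    inner : v ∈ J₀ → ¬ LeftEnd v → WeightView v (n + n + toℕ v)

  weightView : ∀ v → WeightView v (weight v)
  weightView v with v ∈? J₀ | leftEnd? v
  ... | no v∉ | _ = outside v∉
  ... | yes v∈ | yes left = leftEnd v∈ left
  ... | yes v∈ | no ¬left = inner v∈ ¬left

  n≤weight : ∀ {v} → v ∈ J₀ → n ≤ weight v
  n≤weight {v} v∈ with weight v | weightView v
  ... | _ | outside v∉ = contradiction v∈ v∉
  ... | _ | leftEnd _ _ = m≤m+n n _
  ... | _ | inner _ _ = ≤-trans (m≤m+n n n) (m≤m+n (n + n) _)

  weight-outside<inside : ∀ {u v} → u ∉ J₀ → v ∈ J₀ → weight u < weight v
  weight-outside<inside {u} u∉ v∈ with weight u | weightView u
  ... | _ | outside _ = <-≤-trans (toℕ<n u) (n≤weight v∈)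
  ... | _ | leftEnd u∈ _ = contradiction u∈ u∉
  ... | _ | inner u∈ _ = contradiction u∈ u∉

  leftEnd<inner : ∀ u {k} → n + (n ∸ suc (toℕ u)) < n + n + k
  leftEnd<inner u {k} = <-≤-trans (+-monoʳ-< n (∸-monoʳ-< {o = 0} z<s (toℕ<n u))) (m≤m+n (n + n) k)

  weight<3n : ∀ v → weight v < n + n + n
  weight<3n v with weight v | weightView v
  ... | _ | outside _ = <-≤-trans (toℕ<n v) (≤-trans (m≤m+n n n) (m≤m+n (n + n) n))
  ... | _ | leftEnd _ _ = leftEnd<inner v
  ... | _ | inner _ _ = +-monoʳ-< (n + n) (toℕ<n v)

  weight-leftEnd-antitone : ∀ {u v} → u ∈ J₀ → LeftEnd u → v ∈ J₀ → LeftEnd v → toℕ u ≤ toℕ v → weight v ≤ weight u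
  weight-leftEnd-antitone {u} {v} u∈ leftU v∈ leftV u≤v with weight u | weightView u | weight v | weightView v
  ... | _ | leftEnd _ _ | _ | leftEnd _ _ = +-monoʳ-≤ n (∸-monoʳ-≤ n (s≤s u≤v))
  ... | _ | outside u∉ | _ | _ = contradiction u∈ u∉
  ... | _ | inner _ ¬left | _ | _ = contradiction leftU ¬left
  ... | _ | _ | _ | outside v∉ = contradiction v∈ v∉
  ... | _ | _ | _ | inner _ ¬left = contradiction leftV ¬left

  weight-inner-monotone : ∀ {u v} → u ∈ J₀ → ¬ LeftEnd u → v ∈ J₀ → ¬ LeftEnd v → toℕ u ≤ toℕ v → weight u ≤ weight v
  weight-inner-monotone {u} {v} u∈ ¬leftU v∈ ¬leftV u≤v with weight u | weightView u | weight v | weightView v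
  ... | _ | inner _ _ | _ | inner _ _ = +-monoʳ-≤ (n + n) u≤v
  ... | _ | outside u∉ | _ | _ = contradiction u∈ u∉
  ... | _ | leftEnd _ leftU | _ | _ = contradiction leftU ¬leftU
  ... | _ | _ | _ | outside v∉ = contradiction v∈ v∉
  ... | _ | _ | _ | leftEnd _ leftV = contradiction leftV ¬leftV

  weight-injective : ∀ {u v} → weight u ≡ weight v → u ≡ v
  weight-injective {u} {v} eq with weight u | weightView u | weight v | weightView v
  ... | _ | outside _ | _ | outside _ = toℕ-injective eq
  ... | _ | leftEnd _ _ | _ | leftEnd _ _ =
    toℕ-injective (suc-injective (∸-cancelˡ-≡ (toℕ<n u) (toℕ<n v) (+-cancelˡ-≡ n _ _ eq)))
  ... | _ | inner _ _ | _ | inner _ _ = toℕ-injective (+-cancelˡ-≡ (n + n) _ _ eq)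
  ... | _ | outside _ | _ | leftEnd _ _ = contradiction eq (<⇒≢ (<-≤-trans (toℕ<n u) (m≤m+n n _)))
  ... | _ | outside _ | _ | inner _ _ = contradiction eq (<⇒≢ (<-≤-trans (toℕ<n u) (≤-trans (m≤m+n n n) (m≤m+n (n + n) _))))
  ... | _ | leftEnd _ _ | _ | outside _ = contradiction (sym eq) (<⇒≢ (<-≤-trans (toℕ<n v) (m≤m+n n _)))
  ... | _ | inner _ _ | _ | outside _ = contradiction (sym eq) (<⇒≢ (<-≤-trans (toℕ<n v) (≤-trans (m≤m+n n n) (m≤m+n (n + n) _))))
  ... | _ | leftEnd _ _ | _ | inner _ _ = contradiction eq (<⇒≢ (leftEnd<inner u))
  ... | _ | inner _ _ | _ | leftEnd _ _ = contradiction (sym eq) (<⇒≢ (leftEnd<inner v))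

module Sufficiency {n : ℕ} (J₀ : Subset n) (cc : Dynkin.ComponentCondition n J₀) where
  open Dynkin n
  open Subsets
  open PathGraph
  open Admissibility J₀
  open Weight J₀

  Descent : Subset n → Fin n → Set
  Descent c v = ∃ λ d → d ∉ J₀ × (∀ m → Between v d m → m ∈ c × weight m ≤ weight v)

  module _ {v : Fin n} (v∈J₀ : v ∈ J₀) where
    open IntervalComponent (intervalComponent v∈J₀)

    classify : LeftEnd v ⊎ RightEnd v ⊎ Isolated v
    classify with cc carrier isComponent
    ... | inj₁ (i , carrier≡⁅i⁆) = inj₂ (inj₂ isolated)
      where
        ≡i : ∀ {m} → m ∈ carrier → m ≡ i
        ≡i m∈ = x∈⁅y⁆⇒x≡y i (subst (_ ∈_) carrier≡⁅i⁆ m∈)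
        isolated : Isolated v
        isolated m adj m∈J₀ =
          Adjacent⇒≢ adj (trans (≡i i∈carrier) (sym (≡i (proj₂ (proj₂ (proj₂ isComponent)) v m i∈carrier m∈J₀ adj))))
    ... | inj₂ (_ , e , e∈ , endNode) with EndNode⇒extreme endNode
    ...   | inj₁ e≡0 = inj₁ λ m m≤v →
            inside m (≤-trans (proj₁ (∈-interval⁻ e∈)) (≤-trans (≤-reflexive e≡0) z≤n)) (≤-trans m≤v i≤r)
    ...   | inj₂ 1+e≡n = inj₂ (inj₁ λ m v≤m →
            inside m (≤-trans l≤i v≤m) (≤-trans (≤-pred (subst (suc (toℕ m) ≤_) (sym 1+e≡n) (toℕ<n m))) (proj₂ (∈-interval⁻ e∈))))

    descent-leftEnd : ∀ {c} → LeftEnd v → Exit c v → Descent c v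
    descent-leftEnd {c} left (d₀ , d₀∉ , between₀) = d , d∉ , λ m btw → onPath m (Between-ascending v≤d btw)
      where
        v<d₀ : toℕ v < toℕ d₀
        v<d₀ = ≰⇒> (λ d₀≤v → d₀∉ (left d₀ d₀≤v))
        r<d₀ : r < toℕ d₀
        r<d₀ = ≰⇒> (λ d₀≤r → d₀∉ (inside d₀ (≤-trans l≤i (<⇒≤ v<d₀)) d₀≤r))
        d = proj₁ (nodeAt (≤-<-trans r<d₀ (toℕ<n d₀)))
        d≡ : toℕ d ≡ suc r
        d≡ = proj₂ (nodeAt (≤-<-trans r<d₀ (toℕ<n d₀)))
        d∉ : d ∉ J₀
        d∉ = rightOut d d≡
        v≤d : toℕ v ≤ toℕ d
        v≤d = ≤-trans (≤-trans i≤r (n≤1+n r)) (≤-reflexive (sym d≡))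
        onPath : ∀ m → toℕ v ≤ toℕ m × toℕ m ≤ toℕ d → m ∈ c × weight m ≤ weight v
        onPath m (v≤m , m≤d) = between₀ m (inj₁ (v≤m , ≤-trans m≤d (≤-trans (≤-reflexive d≡) r<d₀))) , weight≤
          where
            weight≤ : weight m ≤ weight v
            weight≤ with toℕ m ≤? r
            ... | no m≰r = <⇒≤ (weight-outside<inside (rightOut m (≤-antisym (≤-trans m≤d (≤-reflexive d≡)) (≰⇒> m≰r))) v∈J₀)
            ... | yes m≤r = weight-leftEnd-antitone v∈J₀ left (inside m (≤-trans l≤i v≤m) m≤r) leftM v≤m
              where
                leftM : LeftEnd m
                leftM k k≤m with toℕ k ≤? toℕ v
                ... | yes k≤v = left k k≤v
                ... | no k≰v = inside k (≤-trans l≤i (<⇒≤ (≰⇒> k≰v))) (≤-trans k≤m m≤r)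

    descent-rightEnd : ∀ {c} → RightEnd v → ¬ LeftEnd v → Exit c v → Descent c v
    descent-rightEnd {c} right ¬left (d₀ , d₀∉ , between₀) = d , d∉ , λ m btw → onPath m (Between-descending d≤v btw)
      where
        d₀<v : toℕ d₀ < toℕ v
        d₀<v = ≰⇒> (λ v≤d₀ → d₀∉ (right d₀ v≤d₀))
        d₀<l : toℕ d₀ < l
        d₀<l = ≰⇒> (λ l≤d₀ → d₀∉ (inside d₀ l≤d₀ (≤-trans (<⇒≤ d₀<v) i≤r)))
        d = proj₁ (nodeAt (≤-<-trans (≤-trans pred[n]≤n l≤i) (toℕ<n v)))
        1+d≡l : suc (toℕ d) ≡ l
        1+d≡l = trans (cong suc (proj₂ (nodeAt (≤-<-trans (≤-trans pred[n]≤n l≤i) (toℕ<n v)))))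
                      (suc-pred l {{>-nonZero (≤-<-trans z≤n d₀<l)}})
        d∉ : d ∉ J₀
        d∉ = leftOut d 1+d≡l
        d≤v : toℕ d ≤ toℕ v
        d≤v = ≤-trans (n≤1+n _) (≤-trans (≤-reflexive 1+d≡l) l≤i)
        onPath : ∀ m → toℕ d ≤ toℕ m × toℕ m ≤ toℕ v → m ∈ c × weight m ≤ weight v
        onPath m (d≤m , m≤v) = between₀ m (inj₂ (≤-trans d₀≤d d≤m , m≤v)) , weight≤
          where
            d₀≤d : toℕ d₀ ≤ toℕ d
            d₀≤d = ≤-pred (≤-trans d₀<l (≤-reflexive (sym 1+d≡l)))
            weight≤ : weight m ≤ weight v
            weight≤ with l ≤? toℕ m
            ... | no l≰m = <⇒≤ (weight-outside<inside (leftOut m (≤-antisym (≰⇒> l≰m) (≤-trans (≤-reflexive (sym 1+d≡l)) (s≤s d≤m)))) v∈J₀)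
            ... | yes l≤m = weight-inner-monotone (inside m l≤m (≤-trans m≤v i≤r)) (λ leftM → d∉ (leftM d d≤m)) v∈J₀ ¬left m≤v

  descent-isolated : ∀ {c v} → v ∈ c → v ∈ J₀ → Isolated v → Exit c v → Descent c v
  descent-isolated {c} {v} v∈c v∈J₀ isolated (d₀ , d₀∉ , between₀)
    with stepToward v d₀ (λ v≡d₀ → d₀∉ (subst (_∈ J₀) v≡d₀ v∈J₀))
  ... | s , adj , s-between = s , isolated s adj , onPath
    where
      onPath : ∀ m → Between v s m → m ∈ c × weight m ≤ weight v
      onPath m btw with Between-adjacent adj btw
      ... | inj₁ refl = v∈c , ≤-refl
      ... | inj₂ refl = between₀ s s-between , <⇒≤ (weight-outside<inside (isolated s adj) v∈J₀)

  descent : ∀ {c v} → v ∈ c → Exit c v → Descent c v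
  descent {c} {v} v∈c exit = byCases (v ∈? J₀) (leftEnd? v)
    where
      byCases : Dec (v ∈ J₀) → Dec (LeftEnd v) → Descent c v
      byCases (no v∉) _ = v , v∉ , λ m btw → subst (λ x → x ∈ c × weight x ≤ weight v) (sym (Between-refl btw)) (v∈c , ≤-refl)
      byCases (yes v∈J₀) (yes left) = descent-leftEnd v∈J₀ left exit
      byCases (yes v∈J₀) (no ¬left) with classify v∈J₀
      ... | inj₁ left = contradiction left ¬left
      ... | inj₂ (inj₁ right) = descent-rightEnd v∈J₀ right ¬left exit
      ... | inj₂ (inj₂ isolated) = descent-isolated v∈c v∈J₀ isolated exit

  opaque
    prefix : ℕ → Subset n
    prefix t = setOf (λ v → weight v <? t)

    ∈-prefix⁺ : ∀ {t v} → weight v < t → v ∈ prefix t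
    ∈-prefix⁺ {t} = ∈-setOf⁺ (λ v → weight v <? t)

    ∈-prefix⁻ : ∀ {t v} → v ∈ prefix t → weight v < t
    ∈-prefix⁻ {t} = ∈-setOf⁻ (λ v → weight v <? t)

  Admissible-∩-prefix : ∀ {c} t → Admissible J₀ c → Admissible J₀ (c ∩ prefix t)
  Admissible-∩-prefix {c} t adm = Reaches⇒Admissible λ v v∈ →
    let v∈c , v∈prefix = x∈p∩q⁻ c (prefix t) v∈
        d , d∉J₀ , onPath = descent v∈c (Admissible⇒Exit adm v∈c)
    in d , d∉J₀ , pathBetween v d λ m btw →
         x∈p∩q⁺ (proj₁ (onPath m btw) , ∈-prefix⁺ (≤-<-trans (proj₂ (onPath m btw)) (∈-prefix⁻ v∈prefix)))

  prefix-mono : ∀ {s t} → s ≤ t → prefix s ⊆ prefix t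
  prefix-mono s≤t v∈ = ∈-prefix⁺ (<-≤-trans (∈-prefix⁻ v∈) s≤t)

  prefix-admissible : ∀ {d} → d ∉ J₀ → ∀ t → Admissible J₀ (prefix t)
  prefix-admissible d∉ t = subst (Admissible J₀) (∩-identityˡ (prefix t)) (Admissible-∩-prefix t (Admissible-⊤ d∉))

  prefix-step : ∀ t {u v} → u ∈ prefix (suc t) → u ∉ prefix t → v ∈ prefix (suc t) → v ∉ prefix t → u ≡ v
  prefix-step t u∈ u∉ v∈ v∉ = weight-injective (trans (weight≡ u∈ u∉) (sym (weight≡ v∈ v∉)))
    where
      weight≡ : ∀ {v} → v ∈ prefix (suc t) → v ∉ prefix t → weight v ≡ t
      weight≡ v∈ v∉ = ≤-antisym (≤-pred (∈-prefix⁻ v∈)) (≮⇒≥ (λ lt → v∉ (∈-prefix⁺ lt)))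

  open Filtration prefix (n + n + n) (λ v v∈ → n≮0 (∈-prefix⁻ v∈)) (λ v → ∈-prefix⁺ (weight<3n v)) prefix-step
  open CrossSectionLattice J₀

  Γ : Λ J₀ → Set
  Γ x = proj₁ x ≡ nothing ⊎ ∃ λ t → proj₁ x ≡ just (prefix t)

  Γ-chain : IsChain Γ
  Γ-chain (nothing , _) _ _ _ = inj₁ tt
  Γ-chain (just _ , _) (nothing , _) _ _ = inj₂ tt
  Γ-chain (just _ , _) (just _ , _) (inj₂ (s , refl)) (inj₂ (t , refl)) with ≤-total s t
  ... | inj₁ s≤t = inj₁ (prefix-mono s≤t)
  ... | inj₂ t≤s = inj₂ (prefix-mono t≤s)

  Γ-maximal : ∀ C → IsChain C → (∀ x → Γ x → C x) → ∀ x → C x → Σ (Λ J₀) λ y → Γ y × (x ≈Λ y)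
  Γ-maximal C _ _ x@(nothing , _) _ = x , inj₁ refl , refl
  Γ-maximal C chain Γ⊆C x@(just X , adm) x∈C = x , inj₂ (t , cong just X≡) , refl
    where
      comparable : ∀ t → X ⊆ prefix t ⊎ prefix t ⊆ X
      comparable t with any? (λ d → ¬? (d ∈? J₀))
      ... | yes (d , d∉) = chain x (just (prefix t) , prefix-admissible d∉ t) x∈C (Γ⊆C _ (inj₂ (t , refl)))
      ... | no none = inj₁ λ v∈X → contradiction (Admissible⇒meets-outside adm v∈X) λ (d , d∉) → none (d , d∉)
      t = proj₁ (comparable⇒stage X comparable)
      X≡ = proj₂ (comparable⇒stage X comparable)

  module _ (C : Λ J₀ → Set) (C-chain : IsChain C) where

    Cover : Subset n → Set
    Cover c = Admissible J₀ c × (c ≡ ⊤ ⊎ ∃ λ y → C y × proj₁ y ≡ just c)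

    Cover-comparable : ∀ {c c′} → Cover c → Cover c′ → c ⊆ c′ ⊎ c′ ⊆ c
    Cover-comparable (_ , inj₁ refl) _ = inj₂ ⊆⊤
    Cover-comparable (_ , inj₂ _) (_ , inj₁ refl) = inj₁ ⊆⊤
    Cover-comparable (_ , inj₂ (y@(_ , _) , y∈C , refl)) (_ , inj₂ (y′@(_ , _) , y′∈C , refl)) = C-chain y y′ y∈C y′∈C

    Open : Subset n → Set
    Open X = ∀ v → v ∈ X → ∃ λ c → ∃ λ t → Cover c × v ∈ c ∩ prefix t × c ∩ prefix t ⊆ X

    Open⇒Admissible : ∀ {X} → Open X → Admissible J₀ X
    Open⇒Admissible openX = Reaches⇒Admissible λ v v∈ →
      let c , t , (adm , _) , v∈box , box⊆X = openX v v∈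
          d , d∉J₀ , path = Admissible⇒Reaches (Admissible-∩-prefix t adm) v v∈box
      in d , d∉J₀ , PathIn-mono box⊆X path

    Open-∪ : ∀ {X Y} → Open X → Open Y → Open (X ∪ Y)
    Open-∪ {X} {Y} openX openY v v∈ with x∈p∪q⁻ X Y v∈
    ... | inj₁ v∈X = let c , t , cover , v∈box , box⊆ = openX v v∈X in c , t , cover , v∈box , λ u∈ → p⊆p∪q Y (box⊆ u∈)
    ... | inj₂ v∈Y = let c , t , cover , v∈box , box⊆ = openY v v∈Y in c , t , cover , v∈box , λ u∈ → q⊆p∪q X Y (box⊆ u∈)

    private
      shrink : ∀ {c c′ t t′ v} → c ⊆ c′ → v ∈ c ∩ prefix t → v ∈ c′ ∩ prefix t′ →
               v ∈ c ∩ prefix (t ⊓ t′) × (c ∩ prefix (t ⊓ t′) ⊆ c ∩ prefix t) × (c ∩ prefix (t ⊓ t′) ⊆ c′ ∩ prefix t′)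
      shrink {c} {c′} {t} {t′} c⊆c′ v∈ v∈′ =
          x∈p∩q⁺ (proj₁ (x∈p∩q⁻ _ _ v∈) , ∈-prefix⁺ (⊓-pres-m< (∈-prefix⁻ (proj₂ (x∈p∩q⁻ _ _ v∈))) (∈-prefix⁻ (proj₂ (x∈p∩q⁻ _ _ v∈′)))))
        , (λ u∈ → x∈p∩q⁺ (proj₁ (x∈p∩q⁻ _ _ u∈) , ∈-prefix⁺ (m<n⊓o⇒m<n t t′ (∈-prefix⁻ (proj₂ (x∈p∩q⁻ _ _ u∈))))))
        , (λ u∈ → x∈p∩q⁺ (c⊆c′ (proj₁ (x∈p∩q⁻ _ _ u∈)) , ∈-prefix⁺ (m<n⊓o⇒m<o t t′ (∈-prefix⁻ (proj₂ (x∈p∩q⁻ _ _ u∈))))))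

    Open-∩ : ∀ {X Y} → Open X → Open Y → Open (X ∩ Y)
    Open-∩ {X} {Y} openX openY v v∈ with openX v (proj₁ (x∈p∩q⁻ X Y v∈)) | openY v (proj₂ (x∈p∩q⁻ X Y v∈))
    ... | c , t , coverX , v∈X , ⊆X | c′ , t′ , coverY , v∈Y , ⊆Y with Cover-comparable coverX coverY
    ...   | inj₁ c⊆c′ = let v∈box , ⊆boxX , ⊆boxY = shrink c⊆c′ v∈X v∈Y
                        in c , t ⊓ t′ , coverX , v∈box , λ u∈ → x∈p∩q⁺ (⊆X (⊆boxX u∈) , ⊆Y (⊆boxY u∈))
    ...   | inj₂ c′⊆c = let v∈box , ⊆boxY , ⊆boxX = shrink c′⊆c v∈Y v∈X
                        in c′ , t′ ⊓ t , coverY , v∈box , λ u∈ → x∈p∩q⁺ (⊆X (⊆boxX u∈) , ⊆Y (⊆boxY u∈))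

    open Distributive Open Open⇒Admissible Open-∩ Open-∪

    Γ∪C⇒Open : ∀ x → Γ x ⊎ C x → Q̂ (proj₁ x)
    Γ∪C⇒Open (nothing , _) _ = tt
    Γ∪C⇒Open (just X , adm) (inj₁ (inj₂ (t , refl))) v v∈ =
      ⊤ , t , (Admissible-⊤ (proj₂ (Admissible⇒meets-outside adm v∈)) , inj₁ refl) , x∈p∩q⁺ (∈⊤ , v∈) , p∩q⊆q ⊤ (prefix t)
    Γ∪C⇒Open (just X , adm) (inj₂ x∈C) v v∈ =
      X , n + n + n , (adm , inj₂ ((just X , adm) , x∈C , refl)) , x∈p∩q⁺ (v∈ , ∈-prefix⁺ (weight<3n v)) , p∩q⊆p X _

    Γ∪C-distributive : IsDistributiveOn (Generated (λ x → Γ x ⊎ C x))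
    Γ∪C-distributive = Generated-distributive Γ∪C⇒Open

  supersolvable : ΛSupersolvable J₀
  supersolvable = Γ , (Γ-chain , Γ-maximal) , Γ∪C-distributive

module Necessity {n : ℕ} (J₀ : Subset n) where
  open Dynkin n
  open Subsets
  open PathGraph
  open Admissibility J₀
  open CrossSectionLattice J₀

  module Obstruction (SS : ΛSupersolvable J₀) {i : Fin n} (K : IntervalComponent J₀ i)
                     (0<l : 0 < IntervalComponent.l K) (l<r : IntervalComponent.l K < IntervalComponent.r K)
                     (1+r<n : suc (IntervalComponent.r K) < n) where
    open IntervalComponent K

    Γ : Λ J₀ → Set
    Γ = proj₁ SS

    Γ-maximalChain : IsMaximalChain Γ
    Γ-maximalChain = proj₁ (proj₂ SS)

    Γ-chain : IsChain Γ
    Γ-chain = proj₁ Γ-maximalChain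

    Γ-distributive : ∀ C → IsChain C → IsDistributiveOn (Generated (λ x → Γ x ⊎ C x))
    Γ-distributive = proj₂ (proj₂ SS)

    ΓSet : Subset n → Set
    ΓSet X = ∃ λ γ → Γ γ × proj₁ γ ≡ just X

    ΓSet-admissible : ∀ {X} → ΓSet X → Admissible J₀ X
    ΓSet-admissible ((_ , adm) , _ , refl) = adm

    ΓSet-comparable : ∀ {X Y} → ΓSet X → ΓSet Y → X ⊆ Y ⊎ Y ⊆ X
    ΓSet-comparable (γ@(_ , _) , γ∈ , refl) (δ@(_ , _) , δ∈ , refl) = Γ-chain γ δ γ∈ δ∈

    comparable⇒ΓSet : ∀ {W} → Admissible J₀ W → (∀ {X} → ΓSet X → X ⊆ W ⊎ W ⊆ X) → ΓSet W
    comparable⇒ΓSet {W} adm comparable with proj₂ Γ-maximalChain C C-chain (λ _ γ∈ → inj₁ γ∈) (just W , adm) (inj₂ refl)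
      where
        C : Λ J₀ → Set
        C u = Γ u ⊎ proj₁ u ≡ just W
        versusW : ∀ x → Γ x → leΛ (proj₁ x) (just W) ⊎ leΛ (just W) (proj₁ x)
        versusW (nothing , _) _ = inj₁ tt
        versusW x@(just _ , _) x∈ = comparable (x , x∈ , refl)
        C-chain : IsChain C
        C-chain x y (inj₁ x∈) (inj₁ y∈) = Γ-chain x y x∈ y∈
        C-chain x (_ , _) (inj₁ x∈) (inj₂ refl) = versusW x x∈
        C-chain (_ , _) y (inj₂ refl) (inj₁ y∈) = Sum.swap (versusW y y∈)
        C-chain (_ , _) (_ , _) (inj₂ refl) (inj₂ refl) = inj₁ (leΛ-refl (just W))
    ... | γ , γ∈ , W≡ = γ , γ∈ , sym W≡

    Avoids Meets : Subset n → Set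
    Avoids X = ∀ m → m ∈ X → m ∉ carrier
    Meets X = ∃ λ m → m ∈ X × m ∈ carrier

    avoids⊎meets : ∀ X → Avoids X ⊎ Meets X
    avoids⊎meets X with any? (λ m → (m ∈? X) ×-dec (m ∈? carrier))
    ... | yes found = inj₂ found
    ... | no none = inj₁ λ m m∈X m∈K → none (m , m∈X , m∈K)

    record Entrance : Set where
      field
        outer inner : Fin n
        outer∉J₀ : outer ∉ J₀
        inner∈K : inner ∈ carrier
        inner-adjacent : Adjacent inner outer
        neighbours : ∀ m → Adjacent inner m → m ≡ outer ⊎ m ∈ carrier
        far : Subset n
        far-admissible : Admissible J₀ far
        inner∈far : inner ∈ far
        outer∉far : outer ∉ far
        far-outsideK : ∀ m → m ∈ far → m ∉ carrier → m ∉ J₀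

    Uses : Entrance → Subset n → Set
    Uses e X = Entrance.outer e ∈ X × Entrance.inner e ∈ X

    private
      l<n : l < n
      l<n = <-trans l<r r<n
      qL pL qR pR : Fin n
      qL = proj₁ (nodeAt l<n)
      pL = proj₁ (nodeAt (≤-<-trans pred[n]≤n l<n))
      qR = proj₁ (nodeAt r<n)
      pR = proj₁ (nodeAt 1+r<n)
      qL≡ : toℕ qL ≡ l
      qL≡ = proj₂ (nodeAt l<n)
      1+pL≡ : suc (toℕ pL) ≡ l
      1+pL≡ = trans (cong suc (proj₂ (nodeAt (≤-<-trans pred[n]≤n l<n)))) (suc-pred l {{>-nonZero 0<l}})
      qR≡ : toℕ qR ≡ r
      qR≡ = proj₂ (nodeAt r<n)
      pR≡ : toℕ pR ≡ suc r
      pR≡ = proj₂ (nodeAt 1+r<n)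

    leftEntrance : Entrance
    leftEntrance = record
      { outer = pL ; inner = qL
      ; outer∉J₀ = leftOut pL 1+pL≡
      ; inner∈K = ∈-interval⁺ (≤-reflexive (sym qL≡)) (≤-trans (≤-reflexive qL≡) (<⇒≤ l<r))
      ; inner-adjacent = inj₂ (trans qL≡ (sym 1+pL≡))
      ; neighbours = neighbours
      ; far = interval l (suc r)
      ; far-admissible = Reaches⇒Admissible λ v v∈ → pR , rightOut pR pR≡ , pathBetween v pR (λ m → interval-convex v∈ pR∈far)
      ; inner∈far = ∈-interval⁺ (≤-reflexive (sym qL≡)) (≤-trans (≤-reflexive qL≡) (≤-trans (<⇒≤ l<r) (n≤1+n r)))
      ; outer∉far = λ pL∈ → <⇒≱ (≤-reflexive 1+pL≡) (proj₁ (∈-interval⁻ pL∈))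
      ; far-outsideK = outsideK
      }
      where
        pR∈far : pR ∈ interval l (suc r)
        pR∈far = ∈-interval⁺ (≤-trans (<⇒≤ l<r) (≤-trans (n≤1+n r) (≤-reflexive (sym pR≡)))) (≤-reflexive pR≡)
        neighbours : ∀ m → Adjacent qL m → m ≡ pL ⊎ m ∈ carrier
        neighbours m (inj₁ m≡) = inj₂ (∈-interval⁺ (≤-trans (n≤1+n l) (≤-reflexive (sym (trans m≡ (cong suc qL≡)))))
                                                    (≤-trans (≤-reflexive (trans m≡ (cong suc qL≡))) l<r))
        neighbours m (inj₂ qL≡1+m) = inj₁ (toℕ-injective (suc-injective (trans (sym qL≡1+m) (trans qL≡ (sym 1+pL≡)))))
        outsideK : ∀ m → m ∈ interval l (suc r) → m ∉ carrier → m ∉ J₀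
        outsideK m m∈ m∉K with toℕ m ≤? r
        ... | yes m≤r = contradiction (∈-interval⁺ (proj₁ (∈-interval⁻ m∈)) m≤r) m∉K
        ... | no m≰r = rightOut m (≤-antisym (proj₂ (∈-interval⁻ m∈)) (≰⇒> m≰r))

    rightEntrance : Entrance
    rightEntrance = record
      { outer = pR ; inner = qR
      ; outer∉J₀ = rightOut pR pR≡
      ; inner∈K = ∈-interval⁺ (≤-trans (<⇒≤ l<r) (≤-reflexive (sym qR≡))) (≤-reflexive qR≡)
      ; inner-adjacent = inj₁ (trans pR≡ (cong suc (sym qR≡)))
      ; neighbours = neighbours
      ; far = interval (pred l) r
      ; far-admissible = Reaches⇒Admissible λ v v∈ → pL , leftOut pL 1+pL≡ , pathBetween v pL (λ m → interval-convex v∈ pL∈far)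
      ; inner∈far = ∈-interval⁺ (≤-trans pred[n]≤n (≤-trans (<⇒≤ l<r) (≤-reflexive (sym qR≡)))) (≤-reflexive qR≡)
      ; outer∉far = λ pR∈ → <⇒≱ (≤-reflexive (sym pR≡)) (proj₂ (∈-interval⁻ pR∈))
      ; far-outsideK = outsideK
      }
      where
        pL∈far : pL ∈ interval (pred l) r
        pL∈far = ∈-interval⁺ (≤-reflexive (sym (suc-injective (trans 1+pL≡ (sym (suc-pred l {{>-nonZero 0<l}}))))))
                              (≤-trans (n≤1+n _) (≤-trans (≤-reflexive 1+pL≡) (<⇒≤ l<r)))
        neighbours : ∀ m → Adjacent qR m → m ≡ pR ⊎ m ∈ carrier
        neighbours m (inj₁ m≡) = inj₁ (toℕ-injective (trans m≡ (trans (cong suc qR≡) (sym pR≡))))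
        neighbours m (inj₂ qR≡1+m) = inj₂ (∈-interval⁺ (≤-pred (≤-trans l<r (≤-reflexive (trans (sym qR≡) qR≡1+m))))
                                                        (≤-trans (n≤1+n _) (≤-reflexive (trans (sym qR≡1+m) qR≡))))
        outsideK : ∀ m → m ∈ interval (pred l) r → m ∉ carrier → m ∉ J₀
        outsideK m m∈ m∉K with l ≤? toℕ m
        ... | yes l≤m = contradiction (∈-interval⁺ l≤m (proj₂ (∈-interval⁻ m∈))) m∉K
        ... | no l≰m = leftOut m (≤-antisym (≰⇒> l≰m) (≤-trans (≤-reflexive (sym (suc-pred l {{>-nonZero 0<l}}))) (s≤s (proj₁ (∈-interval⁻ m∈)))))

    meets⇒uses : ∀ {X} → Admissible J₀ X → Meets X → Uses leftEntrance X ⊎ Uses rightEntrance X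
    meets⇒uses adm (k , k∈X , k∈K) with Admissible⇒Exit adm k∈X | ∈-interval⁻ k∈K
    ... | d , d∉J₀ , between | l≤k , k≤r with toℕ d <? l
    ...   | yes d<l = inj₁ ( between pL (inj₂ (≤-pred (≤-trans d<l (≤-reflexive (sym 1+pL≡))) , ≤-trans (n≤1+n _) (≤-trans (≤-reflexive 1+pL≡) l≤k)))
                           , between qL (inj₂ (≤-trans (<⇒≤ d<l) (≤-reflexive (sym qL≡)) , ≤-trans (≤-reflexive qL≡) l≤k)))
    ...   | no d≮l = inj₂ ( between pR (inj₁ (≤-trans k≤r (≤-trans (n≤1+n r) (≤-reflexive (sym pR≡))) , ≤-trans (≤-reflexive pR≡) r<d))
                           , between qR (inj₁ (≤-trans k≤r (≤-reflexive (sym qR≡)) , ≤-trans (≤-reflexive qR≡) (<⇒≤ r<d))))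
      where
        r<d : r < toℕ d
        r<d = ≰⇒> (λ d≤r → d∉J₀ (inside d (≮⇒≥ d≮l) d≤r))

    module LargestAvoiding (member? : ∀ v → Dec (∃ λ X → ΓSet X × Avoids X × v ∈ X)) where

      U : Subset n
      U = setOf member?

      U-avoids : Avoids U
      U-avoids m m∈U = let _ , _ , avoids , m∈X = ∈-setOf⁻ member? m∈U in avoids m m∈X

      avoiding⊆U : ∀ {X} → ΓSet X → Avoids X → X ⊆ U
      avoiding⊆U γ avoids m∈X = ∈-setOf⁺ member? (_ , γ , avoids , m∈X)

      U⊆meeting : ∀ {X} → ΓSet X → Meets X → U ⊆ X
      U⊆meeting γ (k , k∈X , k∈K) m∈U with ∈-setOf⁻ member? m∈U
      ... | Y , γY , avoidsY , m∈Y with ΓSet-comparable γY γ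
      ...   | inj₁ Y⊆X = Y⊆X m∈Y
      ...   | inj₂ X⊆Y = contradiction k∈K (avoidsY k (X⊆Y k∈X))

      U-reaches : Reaches U
      U-reaches v v∈U =
        let Y , γY , avoidsY , v∈Y = ∈-setOf⁻ member? v∈U
            d , d∉J₀ , path = Admissible⇒Reaches (ΓSet-admissible γY) v v∈Y
        in d , d∉J₀ , PathIn-mono (avoiding⊆U γY avoidsY) path

      U-admissible : Admissible J₀ U
      U-admissible = Reaches⇒Admissible U-reaches

      extension∈Γ : ∀ {W} → Admissible J₀ W → U ⊆ W → (∀ {X} → ΓSet X → Meets X → W ⊆ X) → ΓSet W
      extension∈Γ {W} adm U⊆W W⊆meeting = comparable⇒ΓSet adm comparable
        where
          comparable : ∀ {X} → ΓSet X → X ⊆ W ⊎ W ⊆ X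
          comparable {X} γ with avoids⊎meets X
          ... | inj₁ avoids = inj₁ (λ m∈X → U⊆W (avoiding⊆U γ avoids m∈X))
          ... | inj₂ meets = inj₂ (W⊆meeting γ meets)

      module Through (e : Entrance) (entered : ∀ {X} → ΓSet X → Meets X → Uses e X) where
        open Entrance e

        adjoin⊆meeting : ∀ {v} → (∀ {X} → ΓSet X → Meets X → v ∈ X) → ∀ {X} → ΓSet X → Meets X → U ∪ ⁅ v ⁆ ⊆ X
        adjoin⊆meeting {v} v∈meeting γ meets m∈ with x∈p∪q⁻ U ⁅ v ⁆ m∈
        ... | inj₁ m∈U = U⊆meeting γ meets m∈U
        ... | inj₂ m∈⁅v⁆ = subst (_∈ _) (sym (x∈⁅y⁆⇒x≡y v m∈⁅v⁆)) (v∈meeting γ meets)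

        outer∈U : outer ∈ U
        outer∈U = avoiding⊆U W∈Γ W-avoids (q⊆p∪q U ⁅ outer ⁆ (x∈⁅x⁆ outer))
          where
            ⁅outer⁆-outside : ∀ m → m ∈ ⁅ outer ⁆ → m ∉ J₀
            ⁅outer⁆-outside m m∈ = subst (_∉ J₀) (sym (x∈⁅y⁆⇒x≡y outer m∈)) outer∉J₀
            W-avoids : Avoids (U ∪ ⁅ outer ⁆)
            W-avoids m m∈ with x∈p∪q⁻ U _ m∈
            ... | inj₁ m∈U = U-avoids m m∈U
            ... | inj₂ m∈⁅outer⁆ = λ m∈K → ⁅outer⁆-outside m m∈⁅outer⁆ (carrier⊆ m∈K)
            W∈Γ : ΓSet (U ∪ ⁅ outer ⁆)
            W∈Γ = extension∈Γ (Admissible-∪ U-admissible (Admissible-outside ⁅outer⁆-outside))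
                              (p⊆p∪q _) (adjoin⊆meeting (λ γ meets → proj₁ (entered γ meets)))

        W : Subset n
        W = U ∪ ⁅ inner ⁆

        W-reaches : Reaches W
        W-reaches v v∈W with x∈p∪q⁻ U ⁅ inner ⁆ v∈W
        ... | inj₁ v∈U = let d , d∉J₀ , path = U-reaches v v∈U in d , d∉J₀ , PathIn-mono (p⊆p∪q _) path
        ... | inj₂ v∈⁅inner⁆ rewrite x∈⁅y⁆⇒x≡y inner v∈⁅inner⁆ =
          outer , outer∉J₀ , step (here (q⊆p∪q U _ (x∈⁅x⁆ inner))) inner-adjacent (p⊆p∪q _ outer∈U)

        inner∉ : ∀ {V} → Admissible J₀ V → V ⊆ W → V ⊆ far → inner ∉ V
        inner∉ {V} adm V⊆W V⊆far inner∈V with Admissible⇒Exit adm inner∈V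
        ... | d , d∉J₀ , between with stepToward inner d (λ inner≡d → d∉J₀ (subst (_∈ J₀) inner≡d (carrier⊆ inner∈K)))
        ...   | s , adj , s-between with neighbours s adj
        ...     | inj₁ refl = outer∉far (V⊆far (between outer s-between))
        ...     | inj₂ s∈K with x∈p∪q⁻ U ⁅ inner ⁆ (V⊆W (between s s-between))
        ...       | inj₁ s∈U = U-avoids s s∈U s∈K
        ...       | inj₂ s∈⁅inner⁆ = Adjacent⇒≢ adj (sym (x∈⁅y⁆⇒x≡y inner s∈⁅inner⁆))

        W≡U : W ≡ U
        W≡U with extension∈Γ (Reaches⇒Admissible W-reaches) (p⊆p∪q _) (adjoin⊆meeting (λ γ meets → proj₂ (entered γ meets)))
                | extension∈Γ U-admissible (λ m∈ → m∈) U⊆meeting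
        ... | (_ , adW) , W∈Γ , refl | (_ , adU) , U∈Γ , refl =
          distributive-collapse adW adU far-admissible (Γ-distributive C C-chain)
            (gen (inj₁ W∈Γ)) (gen (inj₁ U∈Γ)) (gen (inj₂ refl))
            (p⊆p∪q _) W⊆U∪far
            (Admissible-outside λ m m∈ → far-outsideK m (proj₂ (x∈p∩q⁻ U far m∈)) (U-avoids m (proj₁ (x∈p∩q⁻ U far m∈))))
            below
          where
            C : Λ J₀ → Set
            C u = proj₁ u ≡ just far
            C-chain : IsChain C
            C-chain (_ , _) (_ , _) refl refl = inj₁ (leΛ-refl (just far))
            W⊆U∪far : W ⊆ U ∪ far
            W⊆U∪far m∈ with x∈p∪q⁻ U ⁅ inner ⁆ m∈
            ... | inj₁ m∈U = p⊆p∪q far m∈U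
            ... | inj₂ m∈⁅inner⁆ = q⊆p∪q U far (subst (_∈ far) (sym (x∈⁅y⁆⇒x≡y inner m∈⁅inner⁆)) inner∈far)
            below : ∀ V → Admissible J₀ V → V ⊆ W → V ⊆ far → V ⊆ U
            below V adm V⊆W V⊆far m∈V with x∈p∪q⁻ U ⁅ inner ⁆ (V⊆W m∈V)
            ... | inj₁ m∈U = m∈U
            ... | inj₂ m∈⁅inner⁆ = contradiction (subst (_∈ V) (x∈⁅y⁆⇒x≡y inner m∈⁅inner⁆) m∈V) (inner∉ adm V⊆W V⊆far)

        absurd : Empty
        absurd = U-avoids inner (subst (inner ∈_) W≡U (q⊆p∪q U _ (x∈⁅x⁆ inner))) inner∈K

    entranceChoice : ¬ ¬ ((∀ {X} → ΓSet X → Meets X → Uses leftEntrance X) ⊎ (∀ {X} → ΓSet X → Meets X → Uses rightEntrance X))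
    entranceChoice never = ¬¬-excluded-middle {A = ∃ λ X₀ → ΓSet X₀ × Meets X₀ × ¬ Uses leftEntrance X₀} λ
      { (yes (X₀ , γ₀ , meets₀ , ¬usesLeft₀)) → never (inj₂ (viaRight γ₀ meets₀ ¬usesLeft₀))
      ; (no none) → never (inj₁ λ {X} γ meets → decidable-stable (uses? leftEntrance X) (λ ¬uses → none (X , γ , meets , ¬uses))) }
      where
        uses? : ∀ e X → Dec (Uses e X)
        uses? e X = (Entrance.outer e ∈? X) ×-dec (Entrance.inner e ∈? X)
        viaRight : ∀ {X₀} → ΓSet X₀ → Meets X₀ → ¬ Uses leftEntrance X₀ → ∀ {X} → ΓSet X → Meets X → Uses rightEntrance X
        viaRight γ₀ meets₀ ¬usesLeft₀ γ meets with meets⇒uses (ΓSet-admissible γ) meets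
        ... | inj₂ usesRight = usesRight
        ... | inj₁ (outer∈ , inner∈) with ΓSet-comparable γ γ₀ | meets⇒uses (ΓSet-admissible γ₀) meets₀
        ...   | inj₁ X⊆X₀ | _ = contradiction (X⊆X₀ outer∈ , X⊆X₀ inner∈) ¬usesLeft₀
        ...   | inj₂ _ | inj₁ usesLeft₀ = contradiction usesLeft₀ ¬usesLeft₀
        ...   | inj₂ X₀⊆X | inj₂ (outer∈₀ , inner∈₀) = X₀⊆X outer∈₀ , X₀⊆X inner∈₀

    -- Membership in Γ is undecidable in general; U and the end used are obtained under a double
    -- negation, which is harmless since the goal is ⊥.
    absurd : Empty
    absurd = ¬¬-decidable _ λ member? → entranceChoice λ
      { (inj₁ usesLeft) → LargestAvoiding.Through.absurd member? leftEntrance usesLeft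
      ; (inj₂ usesRight) → LargestAvoiding.Through.absurd member? rightEntrance usesRight }

  module _ (SS : ΛSupersolvable J₀) {C : Subset n} (isC : IsComponent J₀ C) {i : Fin n} (i∈C : i ∈ C)
           (K : IntervalComponent J₀ i) where
    open IntervalComponent K

    C≡carrier : C ≡ carrier
    C≡carrier = components-coincide isC isComponent i∈C i∈carrier

    connected : Connected C
    connected = proj₁ (proj₂ (proj₂ isC))

    componentShape : (Σ (Fin n) λ j → C ≡ ⁅ j ⁆) ⊎ (Connected C × Σ (Fin n) λ j → j ∈ C × EndNode j)
    componentShape with l ≟ r
    ... | yes l≡r = inj₁ (i , trans C≡carrier (⊆-antisym carrier⊆⁅i⁆ ⁅i⁆⊆carrier))
      where
        carrier⊆⁅i⁆ : carrier ⊆ ⁅ i ⁆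
        carrier⊆⁅i⁆ {m} m∈ = subst (_∈ ⁅ i ⁆) (sym (toℕ-injective (≤-antisym
          (≤-trans (proj₂ (∈-interval⁻ m∈)) (≤-trans (≤-reflexive (sym l≡r)) l≤i))
          (≤-trans i≤r (≤-trans (≤-reflexive (sym l≡r)) (proj₁ (∈-interval⁻ m∈))))))) (x∈⁅x⁆ i)
        ⁅i⁆⊆carrier : ⁅ i ⁆ ⊆ carrier
        ⁅i⁆⊆carrier m∈ = subst (_∈ carrier) (sym (x∈⁅y⁆⇒x≡y i m∈)) i∈carrier
    ... | no l≢r with l ≟ 0 | suc r ≟ n
    ...   | yes l≡0 | _ = inj₂ (connected , first , subst (first ∈_) (sym C≡carrier) first∈ , EndNode-first first≡0 second≡1)
      where
        1≤r : 1 ≤ r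
        1≤r = subst (_< r) l≡0 (≤∧≢⇒< (≤-trans l≤i i≤r) l≢r)
        first = proj₁ (nodeAt (≤-<-trans z≤n r<n))
        first≡0 = proj₂ (nodeAt (≤-<-trans z≤n r<n))
        second≡1 = proj₂ (nodeAt (≤-<-trans 1≤r r<n))
        first∈ : first ∈ carrier
        first∈ = ∈-interval⁺ (≤-trans (≤-reflexive l≡0) (≤-reflexive (sym first≡0))) (≤-trans (≤-reflexive first≡0) z≤n)
    ...   | no _ | yes 1+r≡n = inj₂ (connected , last , subst (last ∈_) (sym C≡carrier) last∈ , EndNode-last (trans (cong suc last≡r) 1+r≡n) 1+previous≡)
      where
        last = proj₁ (nodeAt r<n)
        last≡r = proj₂ (nodeAt r<n)
        previous = proj₁ (nodeAt (≤-<-trans pred[n]≤n r<n))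
        1+previous≡ : suc (toℕ previous) ≡ toℕ last
        1+previous≡ = trans (cong suc (proj₂ (nodeAt (≤-<-trans pred[n]≤n r<n))))
                            (trans (suc-pred r {{>-nonZero (≤-<-trans z≤n (≤∧≢⇒< (≤-trans l≤i i≤r) l≢r))}}) (sym last≡r))
        last∈ : last ∈ carrier
        last∈ = ∈-interval⁺ (≤-trans (≤-trans l≤i i≤r) (≤-reflexive (sym last≡r))) (≤-reflexive last≡r)
    ...   | no l≢0 | no 1+r≢n =
      ⊥-elim (Obstruction.absurd SS K (n≢0⇒n>0 l≢0) (≤∧≢⇒< (≤-trans l≤i i≤r) l≢r) (≤∧≢⇒< r<n 1+r≢n))

  supersolvable⇒componentCondition : ΛSupersolvable J₀ → ComponentCondition J₀
  supersolvable⇒componentCondition SS C isC@((i , i∈C) , C⊆J₀ , _) = componentShape SS isC i∈C (intervalComponent (C⊆J₀ i∈C))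

mainTheorem13 : (n : ℕ) → n ≥ 1 → (J₀ : Subset n) →
    (Dynkin.ΛSupersolvable n J₀ → Dynkin.ComponentCondition n J₀) ×
    (Dynkin.ComponentCondition n J₀ → Dynkin.ΛSupersolvable n J₀)
mainTheorem13 n _ J₀ = Necessity.supersolvable⇒componentCondition J₀ , Sufficiency.supersolvable J₀
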